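{- Let $\mathbb{F}_{243}$ be the field with $243$ elements and let $G_{243,22}=\{x\in\mathbb{F}_{243}: x^{22}=1\}$ be the unique subgroup of order $22$ of $\mathbb{F}_{243}^\times$. For $a,b,c\in G_{243,22}$, we have $a+b+c=0$ if and only if $a=b=c$. -}

module Defs where

open import Data.Nat using (ℕ; zero; suc)

data F3 : Set where
  z0 z1 z2 : F3

infixl 6 _+₃_
infixl 7 _*₃_

_+₃_ : F3 → F3 → F3
z0 +₃ y  = y
z1 +₃ z0 = z1
z1 +₃ z1 = z2
z1 +₃ z2 = z0
z2 +₃ z0 = z2
z2 +₃ z1 = z0
z2 +₃ z2 = z1

_*₃_ : F3 → F3 → F3
z0 *₃ y  = z0
z1 *₃ y  = y
z2 *₃ z0 = z0
z2 *₃ z1 = z2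
z2 *₃ z2 = z1

-- The field 𝔽₂₄₃ = 𝔽₃[X]/(X⁵ + 2X + 1)  (X⁵ + 2X + 1 is irreducible over 𝔽₃;
-- it is the Conway polynomial for 3⁵).  An element c₀ + c₁α + … + c₄α⁴.
record F243 : Set where
  constructor el
  field
    c0 c1 c2 c3 c4 : F3

infixl 6 _+_
infixl 7 _*_
infixr 8 _^_

_+_ : F243 → F243 → F243
el a0 a1 a2 a3 a4 + el b0 b1 b2 b3 b4 =
  el (a0 +₃ b0) (a1 +₃ b1) (a2 +₃ b2) (a3 +₃ b3) (a4 +₃ b4)

0F : F243
0F = el z0 z0 z0 z0 z0

1F : F243
1F = el z1 z0 z0 z0 z0

-- Multiplication: convolution, then reduction using α⁵ = α + 2,
-- α⁶ = α² + 2α, α⁷ = α³ + 2α², α⁸ = α⁴ + 2α³.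
_*_ : F243 → F243 → F243
el a0 a1 a2 a3 a4 * el b0 b1 b2 b3 b4 =
  el (d0 +₃ z2 *₃ d5)
     (d1 +₃ d5 +₃ z2 *₃ d6)
     (d2 +₃ d6 +₃ z2 *₃ d7)
     (d3 +₃ d7 +₃ z2 *₃ d8)
     (d4 +₃ d8)
  where
  d0 = a0 *₃ b0
  d1 = a0 *₃ b1 +₃ a1 *₃ b0
  d2 = a0 *₃ b2 +₃ a1 *₃ b1 +₃ a2 *₃ b0
  d3 = a0 *₃ b3 +₃ a1 *₃ b2 +₃ a2 *₃ b1 +₃ a3 *₃ b0
  d4 = a0 *₃ b4 +₃ a1 *₃ b3 +₃ a2 *₃ b2 +₃ a3 *₃ b1 +₃ a4 *₃ b0
  d5 = a1 *₃ b4 +₃ a2 *₃ b3 +₃ a3 *₃ b2 +₃ a4 *₃ b1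
  d6 = a2 *₃ b4 +₃ a3 *₃ b3 +₃ a4 *₃ b2
  d7 = a3 *₃ b4 +₃ a4 *₃ b3
  d8 = a4 *₃ b4

_^_ : F243 → ℕ → F243
x ^ zero  = 1F
x ^ suc n = x * x ^ n

-- If a + b + c = 0 then c = −(a + b), so it suffices that for 22nd roots of unity a and b
-- the element −(a + b) is again a 22nd root only when a = b.  That is a finite fact about
-- 𝔽₂₄₃, decided by evaluation.  Conversely a + a + a = 0 because 𝔽₂₄₃ has characteristic 3.
module Submission where

open import Data.Nat using (ℕ)
open import Data.Product using (_×_; _,_)
open import Function.Bundles using (_⇔_; mk⇔)
open import Relation.Binary.Definitions using (DecidableEquality)
open import Relation.Binary.PropositionalEquality using (_≡_; refl; cong; sym; subst; module ≡-Reasoning)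
open import Relation.Nullary.Decidable using (Dec; yes; no; map′; _×-dec_; _→-dec_; toWitness)
open import Relation.Unary using (Pred; Decidable)

open import Defs

open ≡-Reasoning

-₃_ : F3 → F3
-₃ z0 = z0
-₃ z1 = z2
-₃ z2 = z1

-_ : F243 → F243
- el a0 a1 a2 a3 a4 = el (-₃ a0) (-₃ a1) (-₃ a2) (-₃ a3) (-₃ a4)

+₃-inverseʳ-unique : ∀ x y → x +₃ y ≡ z0 → y ≡ -₃ x
+₃-inverseʳ-unique z0 z0 refl = refl
+₃-inverseʳ-unique z1 z2 refl = refl
+₃-inverseʳ-unique z2 z1 refl = refl

+-inverseʳ-unique : ∀ x y → x + y ≡ 0F → y ≡ - x
+-inverseʳ-unique (el a0 a1 a2 a3 a4) (el b0 b1 b2 b3 b4) x+y≡0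
  with +₃-inverseʳ-unique a0 b0 (cong F243.c0 x+y≡0)
     | +₃-inverseʳ-unique a1 b1 (cong F243.c1 x+y≡0)
     | +₃-inverseʳ-unique a2 b2 (cong F243.c2 x+y≡0)
     | +₃-inverseʳ-unique a3 b3 (cong F243.c3 x+y≡0)
     | +₃-inverseʳ-unique a4 b4 (cong F243.c4 x+y≡0)
... | refl | refl | refl | refl | refl = refl

+₃-thrice : ∀ x → x +₃ x +₃ x ≡ z0
+₃-thrice z0 = refl
+₃-thrice z1 = refl
+₃-thrice z2 = refl

+-thrice : ∀ x → x + x + x ≡ 0F
+-thrice (el a0 a1 a2 a3 a4)
  rewrite +₃-thrice a0 | +₃-thrice a1 | +₃-thrice a2 | +₃-thrice a3 | +₃-thrice a4 = refl

-‿double : ∀ x → - (x + x) ≡ x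
-‿double x = sym (+-inverseʳ-unique (x + x) x (+-thrice x))

infix 4 _≟₃_ _≟_

_≟₃_ : DecidableEquality F3
z0 ≟₃ z0 = yes refl
z1 ≟₃ z1 = yes refl
z2 ≟₃ z2 = yes refl
z0 ≟₃ z1 = no λ ()
z0 ≟₃ z2 = no λ ()
z1 ≟₃ z0 = no λ ()
z1 ≟₃ z2 = no λ ()
z2 ≟₃ z0 = no λ ()
z2 ≟₃ z1 = no λ ()

_≟_ : DecidableEquality F243
el a0 a1 a2 a3 a4 ≟ el b0 b1 b2 b3 b4 =
  map′ (λ { (refl , refl , refl , refl , refl) → refl })
       (λ { refl → refl , refl , refl , refl , refl })
       (a0 ≟₃ b0 ×-dec a1 ≟₃ b1 ×-dec a2 ≟₃ b2 ×-dec a3 ≟₃ b3 ×-dec a4 ≟₃ b4)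

all₃? : ∀ {p} {P : Pred F3 p} → Decidable P → Dec (∀ x → P x)
all₃? P? = map′ (λ { (p0 , p1 , p2) → λ { z0 → p0 ; z1 → p1 ; z2 → p2 } })
                (λ p → p z0 , p z1 , p z2)
                (P? z0 ×-dec P? z1 ×-dec P? z2)

all? : ∀ {p} {P : Pred F243 p} → Decidable P → Dec (∀ x → P x)
all? P? = map′ (λ p → λ { (el a0 a1 a2 a3 a4) → p a0 a1 a2 a3 a4 })
               (λ p a0 a1 a2 a3 a4 → p (el a0 a1 a2 a3 a4))
               (all₃? λ a0 → all₃? λ a1 → all₃? λ a2 → all₃? λ a3 → all₃? λ a4 →
                  P? (el a0 a1 a2 a3 a4))

IsRoot : ℕ → Pred F243 _
IsRoot n x = x ^ n ≡ 1F

-- `_→-dec_` short-circuits, so b ranges over 𝔽₂₄₃ only for the 22 roots a.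
roots₂₂-neg-sum-root⇒≡ : ∀ a → IsRoot 22 a → ∀ b → IsRoot 22 b → IsRoot 22 (- (a + b)) → a ≡ b
roots₂₂-neg-sum-root⇒≡ = toWitness {a? = decision} _
  where
  decision : Dec (∀ a → IsRoot 22 a → ∀ b → IsRoot 22 b → IsRoot 22 (- (a + b)) → a ≡ b)
  decision = all? λ a → (a ^ 22 ≟ 1F) →-dec all? λ b →
               (b ^ 22 ≟ 1F) →-dec ((- (a + b)) ^ 22 ≟ 1F) →-dec (a ≟ b)

theorem1 : (a b c : F243) → a ^ 22 ≡ 1F → b ^ 22 ≡ 1F → c ^ 22 ≡ 1F →
    (a + b + c ≡ 0F) ⇔ (a ≡ b × b ≡ c)
theorem1 a b c ha hb hc = mk⇔ to from
  where
  to : a + b + c ≡ 0F → a ≡ b × b ≡ c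
  -- Matching c≡-[a+b] against refl would make Agda normalise (- (a + b)) ^ 22 symbolically.
  to a+b+c≡0 = a≡b , b≡c
    where
    c≡-[a+b] : c ≡ - (a + b)
    c≡-[a+b] = +-inverseʳ-unique (a + b) c a+b+c≡0

    a≡b : a ≡ b
    a≡b = roots₂₂-neg-sum-root⇒≡ a ha b hb (subst (IsRoot 22) c≡-[a+b] hc)

    b≡c : b ≡ c
    b≡c = begin
      b            ≡⟨ sym (-‿double b) ⟩
      - (b + b)    ≡⟨ cong (λ x → - (x + b)) (sym a≡b) ⟩
      - (a + b)    ≡⟨ sym c≡-[a+b] ⟩
      c            ∎

  from : a ≡ b × b ≡ c → a + b + c ≡ 0F
  from (refl , refl) = +-thrice a
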